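{- Let $n\ge 1$ and let $\mathcal F\subseteq 2^{[n]}$ be a simply rooted family of sets such that $\emptyset\in\mathcal F$. For $0\le k\le n$ let $\mathcal C_k(\mathcal F)=\{[A,B]: A\subseteq B,\ [A,B]\subseteq\mathcal F,\ |B\setminus A|=k\}$. Then $$\sum_{k=0}^n (-1)^k|\mathcal C_k(\mathcal F)| = 1.$$
   Context: $[n]=\{1,\dots,n\}$, $2^{[n]}$ its power set. For $A,B\in 2^{[n]}$, $[A,B]=\{C\in 2^{[n]}: A\subseteq C\subseteq B\}$ and $[i,B]$ means $[\{i\},B]$. A family $\mathcal F\subseteq 2^{[n]}$ is simply rooted if for every non-empty $A\in\mathcal F$ there is $i\in A$ with $[i,A]\subseteq\mathcal F$. -}

module Defs where

open import Level using (0ℓ)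
open import Data.Bool using (Bool; true; false; _∧_; _∨_; not)
open import Data.Nat using (ℕ; zero; suc; _≡ᵇ_)
open import Data.Integer using (ℤ; +_; -_; _+_; _*_)
open import Data.Fin using (Fin)
open import Data.Fin.Subset.Properties using (_⊆?_)
open import Data.Fin.Subset using (Subset; _⊆_; _─_; ∣_∣; ⁅_⁆; _∈_; Nonempty)
open import Data.List using (List; []; _∷_; map; concatMap; filterᵇ; length)
open import Data.Vec using (_∷_; [])
open import Data.Product using (_×_; _,_; ∃-syntax)
open import Relation.Nullary.Decidable using (⌊_⌋)
open import Relation.Unary using (Pred; Decidable)
open import Relation.Binary.PropositionalEquality using (_≡_)

allᵇ : ∀ {A : Set} → (A → Bool) → List A → Bool
allᵇ p [] = true
allᵇ p (x ∷ xs) = p x ∧ allᵇ p xs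

allSubsets : (n : ℕ) → List (Subset n)
allSubsets zero = [] ∷ []
allSubsets (suc n) = map (true ∷_) (allSubsets n) ++' map (false ∷_) (allSubsets n)
  where
  open import Data.List using () renaming (_++_ to _++'_)

_∈[_,_] : ∀ {n} → Subset n → Subset n → Subset n → Set
C ∈[ A , B ] = A ⊆ C × C ⊆ B

SimplyRooted : ∀ {n} → Pred (Subset n) 0ℓ → Set
SimplyRooted {n} F =
  ∀ A → F A → Nonempty A →
    ∃[ i ] (i ∈ A × (∀ C → C ∈[ ⁅ i ⁆ , A ] → F C))

intervalInᵇ : ∀ {n} {F : Pred (Subset n) 0ℓ} → Decidable F →
              Subset n → Subset n → Bool
intervalInᵇ {n} F? A B =
  allᵇ (λ C → not (⌊ A ⊆? C ⌋ ∧ ⌊ C ⊆? B ⌋) ∨ ⌊ F? C ⌋) (allSubsets n)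

-- |C_k(F)|: number of intervals [A,B] with A ⊆ B, [A,B] ⊆ F, |B \ A| = k.
-- (Distinct pairs A ⊆ B give distinct intervals, so we count the pairs.)
countC : ∀ {n} {F : Pred (Subset n) 0ℓ} → Decidable F → ℕ → ℕ
countC {n} F? k =
  length (filterᵇ (λ { (A , B) → ⌊ A ⊆? B ⌋ ∧ intervalInᵇ F? A B ∧ (∣ B ─ A ∣ ≡ᵇ k) })
                  (concatMap (λ A → map (A ,_) (allSubsets n)) (allSubsets n)))

sign : ℕ → ℤ
sign zero = + 1
sign (suc k) = - sign k

sumTo : ℕ → (ℕ → ℤ) → ℤ
sumTo zero f = f zero
sumTo (suc m) f = sumTo m f + f (suc m)

{-# OPTIONS --safe #-}
module Submission where

-- Group the cubes [A,B] ⊆ F by their top B and put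
-- χ(B) = Σ_{A : [A,B] ⊆ F} (-1)^{|B∖A|}; the alternating sum is Σ_B χ(B).
-- Since ∅ ∈ F, χ(∅) = 1, and χ(B) = 0 for B ≠ ∅ by induction on |B|.
-- If B ∉ F no cube has top B.  Otherwise pick a root i of B and pair each
-- A ∌ i with A ∪ {i}.  Because [i,B] ⊆ F, the cubes [A,B] with i ∉ A are
-- exactly the cubes [A,B-i], with the opposite sign, while [A ∪ {i},B] is
-- a cube for every A ⊆ B-i, so that part of the sum is χ(B-i) for the full
-- family U:
--   χ_F(B) = -χ_F(B-i) + χ_U(B-i).
-- By induction both terms on the right are 0 if B-i ≠ ∅ and 1 if B-i = ∅.

open import Defs
open import Level using (0ℓ)
open import Function using (_∘_; _⇔_; mk⇔)
open import Data.Bool using (Bool; true; false; _∧_; if_then_else_)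
open import Data.Bool.Properties using (∧-assoc)
open import Data.Nat using (ℕ; zero; suc; _≤_; _<_; _≥_; z≤n; s≤s)
open import Data.Nat.Properties using (_≟_; ≤-refl; ≤-pred; m≤n⇒m≤1+n; m≤n⇒m<n∨m≡n; <⇒≢; >⇒≢)
open import Data.Nat.Induction using (<-wellFounded)
open import Induction.WellFounded using (Acc; acc)
open import Data.Integer using (ℤ; +_; -_; _+_; _*_)
import Data.Integer.Properties as ℤ
open import Algebra.Properties.CommutativeSemigroup ℤ.+-commutativeSemigroup using (interchange)
open import Data.List using (List; []; _∷_; map; concatMap; filterᵇ; length; _++_)
import Data.List.Relation.Unary.Any as Any
open import Data.List.Relation.Unary.All as All using (All; []; _∷_)
open import Data.List.Membership.Propositional using () renaming (_∈_ to _∈ₗ_)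
open import Data.List.Membership.Propositional.Properties using (∈-++⁺ˡ; ∈-++⁺ʳ; ∈-map⁺)
open import Data.Product using (_×_; _,_)
open import Data.Sum using (inj₁; inj₂)
open import Data.Fin using (Fin; zero; suc)
open import Data.Vec using ([]; _∷_; here; there)
open import Data.Fin.Subset
  using (Subset; ⊥; _⊆_; _∪_; _─_; _-_; ∣_∣; ⁅_⁆; _∈_; _∉_; Nonempty; inside; outside)
open import Data.Fin.Subset.Properties
  using ( _⊆?_; _∈?_; nonempty?; Empty-unique; ⊆-refl; ⊆-trans; ⊆-antisym; ⊥⊆; ∉⊥; ∣⊥∣≡0
        ; x∈⁅x⁆; x∈⁅y⁆⇒x≡y; p⊆p∪q; q⊆p∪q; x∈p∪q⁻; ∪-comm; ∪-identityʳ
        ; ∣p∣≤n; p─⊥≡p; p─q─r≡p─q∪r; p─q─r≡p─r─q; x∈p∧x∉q⇒x∈p─q; p─q⊆p; x∈p∧x≢y⇒x∈p-y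
        ; x∈p⇒∣p-x∣<∣p∣)
open import Relation.Nullary using (¬_; Dec; yes; no; _because_; does; proof)
open import Relation.Nullary.Reflects using (Reflects; ofʸ; ofⁿ; _×-reflects_; _→-reflects_)
open import Relation.Nullary.Decidable using (⌊_⌋; map′; dec-true; dec-false; does-⇔)
open import Relation.Unary using (Pred; Decidable; U)
open import Relation.Unary.Properties using (U?)
open import Relation.Binary.PropositionalEquality
  using (_≡_; refl; sym; trans; cong; cong₂; subst; module ≡-Reasoning)

∑ : {X : Set} → List X → (X → ℤ) → ℤ
∑ []       f = + 0
∑ (x ∷ xs) f = f x + ∑ xs f

syntax ∑ xs (λ x → e) = ∑[ x ∈ xs ] e

module _ {X : Set} where

  ∑-cong : ∀ xs {f g : X → ℤ} → (∀ x → f x ≡ g x) → ∑ xs f ≡ ∑ xs g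
  ∑-cong []       f≗g = refl
  ∑-cong (x ∷ xs) f≗g = cong₂ _+_ (f≗g x) (∑-cong xs f≗g)

  ∑-vanishes : ∀ xs {f : X → ℤ} → (∀ x → f x ≡ + 0) → ∑ xs f ≡ + 0
  ∑-vanishes []       f≗0 = refl
  ∑-vanishes (x ∷ xs) f≗0 = cong₂ _+_ (f≗0 x) (∑-vanishes xs f≗0)

  ∑-distrib-+ : ∀ xs (f g : X → ℤ) → ∑[ x ∈ xs ] (f x + g x) ≡ ∑ xs f + ∑ xs g
  ∑-distrib-+ []       f g = refl
  ∑-distrib-+ (x ∷ xs) f g =
    trans (cong (_+_ (f x + g x)) (∑-distrib-+ xs f g)) (interchange (f x) (g x) _ _)

  ∑-neg : ∀ xs (f : X → ℤ) → ∑[ x ∈ xs ] (- f x) ≡ - ∑ xs f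
  ∑-neg []       f = refl
  ∑-neg (x ∷ xs) f = trans (cong (_+_ (- f x)) (∑-neg xs f)) (sym (ℤ.neg-distrib-+ (f x) (∑ xs f)))

  ∑-++ : ∀ xs ys (f : X → ℤ) → ∑ (xs ++ ys) f ≡ ∑ xs f + ∑ ys f
  ∑-++ []       ys f = sym (ℤ.+-identityˡ _)
  ∑-++ (x ∷ xs) ys f = trans (cong (_+_ (f x)) (∑-++ xs ys f)) (sym (ℤ.+-assoc (f x) _ _))

∑-map : ∀ {X Y : Set} (h : X → Y) xs (f : Y → ℤ) → ∑ (map h xs) f ≡ ∑ xs (f ∘ h)
∑-map h []       f = refl
∑-map h (x ∷ xs) f = cong (_+_ (f (h x))) (∑-map h xs f)

module _ {X Y : Set} where

  ∑-comm : ∀ xs ys (f : X → Y → ℤ) →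
           ∑[ x ∈ xs ] ∑[ y ∈ ys ] f x y ≡ ∑[ y ∈ ys ] ∑[ x ∈ xs ] f x y
  ∑-comm []       ys f = sym (∑-vanishes ys (λ _ → refl))
  ∑-comm (x ∷ xs) ys f =
    trans (cong (_+_ (∑ ys (f x))) (∑-comm xs ys f)) (sym (∑-distrib-+ ys (f x) _))

  ∑-pairs : ∀ xs ys (f : X × Y → ℤ) →
            ∑ (concatMap (λ x → map (x ,_) ys) xs) f ≡ ∑[ x ∈ xs ] ∑[ y ∈ ys ] f (x , y)
  ∑-pairs []       ys f = refl
  ∑-pairs (x ∷ xs) ys f =
    trans (∑-++ (map (x ,_) ys) _ f) (cong₂ _+_ (∑-map (x ,_) ys f) (∑-pairs xs ys f))

sumTo-cong : ∀ m {f g : ℕ → ℤ} → (∀ k → f k ≡ g k) → sumTo m f ≡ sumTo m g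
sumTo-cong zero    f≗g = f≗g zero
sumTo-cong (suc m) f≗g = cong₂ _+_ (sumTo-cong m f≗g) (f≗g (suc m))

sumTo-distrib-+ : ∀ m (f g : ℕ → ℤ) → sumTo m (λ k → f k + g k) ≡ sumTo m f + sumTo m g
sumTo-distrib-+ zero    f g = refl
sumTo-distrib-+ (suc m) f g =
  trans (cong (_+ (f (suc m) + g (suc m))) (sumTo-distrib-+ m f g)) (interchange (sumTo m f) _ _ _)

sumTo-vanishes : ∀ m {f : ℕ → ℤ} → (∀ k → k ≤ m → f k ≡ + 0) → sumTo m f ≡ + 0
sumTo-vanishes zero    f≗0 = f≗0 zero z≤n
sumTo-vanishes (suc m) f≗0 =
  cong₂ _+_ (sumTo-vanishes m (λ k k≤m → f≗0 k (m≤n⇒m≤1+n k≤m))) (f≗0 (suc m) ≤-refl)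

sumTo-indicator : ∀ (w : ℕ → ℤ) {d} m → d ≤ m →
                  sumTo m (λ k → if does (d ≟ k) then w k else + 0) ≡ w d
sumTo-indicator w zero z≤n = refl
sumTo-indicator w {d} (suc m) d≤1+m with m≤n⇒m<n∨m≡n d≤1+m
... | inj₁ d<1+m = trans
  (cong₂ _+_ (sumTo-indicator w m (≤-pred d<1+m))
             (cong (λ b → if b then w (suc m) else + 0) (dec-false (d ≟ suc m) (<⇒≢ d<1+m))))
  (ℤ.+-identityʳ (w d))
... | inj₂ refl = trans
  (cong₂ _+_ (sumTo-vanishes m (λ k k≤m →
                cong (λ b → if b then w k else + 0) (dec-false (suc m ≟ k) (>⇒≢ (s≤s k≤m)))))
             (cong (λ b → if b then w (suc m) else + 0) (dec-true (suc m ≟ suc m) refl)))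
  (ℤ.+-identityˡ (w (suc m)))

module _ {X : Set} (w : ℕ → ℤ) (p : X → Bool) (d : X → ℕ) (q : ℕ → X → Bool)
         (q≗p∧d≡ : ∀ k x → q k x ≡ p x ∧ does (d x ≟ k)) {m} (d≤m : ∀ x → d x ≤ m) where

  sumTo-weighted-counts : ∀ xs →
    sumTo m (λ k → w k * + length (filterᵇ (q k) xs)) ≡ ∑[ x ∈ xs ] (if p x then w (d x) else + 0)
  sumTo-weighted-counts []       = sumTo-vanishes m (λ k _ → ℤ.*-zeroʳ (w k))
  sumTo-weighted-counts (x ∷ xs) = begin
      sumTo m (λ k → w k * + length (filterᵇ (q k) (x ∷ xs)))
    ≡⟨ sumTo-cong m count-head ⟩
      sumTo m (λ k → (if q k x then w k else + 0) + w k * + length (filterᵇ (q k) xs))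
    ≡⟨ sumTo-distrib-+ m _ _ ⟩
      sumTo m (λ k → if q k x then w k else + 0) + sumTo m (λ k → w k * + length (filterᵇ (q k) xs))
    ≡⟨ cong₂ _+_ head (sumTo-weighted-counts xs) ⟩
      (if p x then w (d x) else + 0) + ∑[ y ∈ xs ] (if p y then w (d y) else + 0)
    ∎
    where
    open ≡-Reasoning

    count-head : ∀ k → w k * + length (filterᵇ (q k) (x ∷ xs))
                     ≡ (if q k x then w k else + 0) + w k * + length (filterᵇ (q k) xs)
    count-head k with q k x
    ... | true  = ℤ.*-suc (w k) (+ length (filterᵇ (q k) xs))
    ... | false = sym (ℤ.+-identityˡ _)

    head : sumTo m (λ k → if q k x then w k else + 0) ≡ (if p x then w (d x) else + 0)
    head = trans (sumTo-cong m (λ k → cong (λ b → if b then w k else + 0) (q≗p∧d≡ k x)))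
                 (indicator (p x))
      where
      indicator : ∀ b → sumTo m (λ k → if b ∧ does (d x ≟ k) then w k else + 0)
                        ≡ (if b then w (d x) else + 0)
      indicator true  = sumTo-indicator w m (d≤m x)
      indicator false = sumTo-vanishes m (λ _ _ → refl)

x∈p⇒⁅x⁆⊆p : ∀ {n} {x : Fin n} {p : Subset n} → x ∈ p → ⁅ x ⁆ ⊆ p
x∈p⇒⁅x⁆⊆p {x = x} {p} x∈p y∈⁅x⁆ = subst (_∈ p) (sym (x∈⁅y⁆⇒x≡y x y∈⁅x⁆)) x∈p

p⊆r∧q⊆r⇒p∪q⊆r : ∀ {n} {p q r : Subset n} → p ⊆ r → q ⊆ r → p ∪ q ⊆ r
p⊆r∧q⊆r⇒p∪q⊆r {p = p} {q} p⊆r q⊆r x∈p∪q with x∈p∪q⁻ p q x∈p∪q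
... | inj₁ x∈p = p⊆r x∈p
... | inj₂ x∈q = q⊆r x∈q

x∉p∧p⊆q⇒p⊆q-x : ∀ {n} {x : Fin n} {p q : Subset n} → x ∉ p → p ⊆ q → p ⊆ q - x
x∉p∧p⊆q⇒p⊆q-x x∉p p⊆q y∈p = x∈p∧x≢y⇒x∈p-y (p⊆q y∈p) (λ { refl → x∉p y∈p })

x∉p-x : ∀ {n} {x : Fin n} (p : Subset n) → x ∉ p - x
x∉p-x {x = zero}  (_ ∷ p) ()
x∉p-x {x = suc x} (_ ∷ p) (there x∈p-x) = x∉p-x p x∈p-x

x∈p⇒∣p∣≡1+∣p-x∣ : ∀ {n} {x : Fin n} {p : Subset n} → x ∈ p → ∣ p ∣ ≡ suc ∣ p - x ∣
x∈p⇒∣p∣≡1+∣p-x∣ {p = inside  ∷ p} here = cong (suc ∘ ∣_∣) (sym (p─⊥≡p p))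
x∈p⇒∣p∣≡1+∣p-x∣ {p = inside  ∷ p} (there x∈p) = cong suc (x∈p⇒∣p∣≡1+∣p-x∣ x∈p)
x∈p⇒∣p∣≡1+∣p-x∣ {p = outside ∷ p} (there x∈p) = x∈p⇒∣p∣≡1+∣p-x∣ x∈p

p─q∪⁅x⁆≡p-x─q : ∀ {n} (p q : Subset n) x → p ─ (q ∪ ⁅ x ⁆) ≡ p - x ─ q
p─q∪⁅x⁆≡p-x─q p q x = trans (cong (p ─_) (∪-comm q ⁅ x ⁆)) (sym (p─q─r≡p─q∪r p ⁅ x ⁆ q))

x∈p∧x∉q⇒∣p─q∣≡1+∣p-x─q∣ : ∀ {n} {x : Fin n} {p q : Subset n} → x ∈ p → x ∉ q →
                           ∣ p ─ q ∣ ≡ suc ∣ p - x ─ q ∣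
x∈p∧x∉q⇒∣p─q∣≡1+∣p-x─q∣ {x = x} {p} {q} x∈p x∉q =
  trans (x∈p⇒∣p∣≡1+∣p-x∣ (x∈p∧x∉q⇒x∈p─q x∈p x∉q)) (cong (suc ∘ ∣_∣) (p─q─r≡p─r─q p q ⁅ x ⁆))

∈-allSubsets : ∀ {n} (p : Subset n) → p ∈ₗ allSubsets n
∈-allSubsets []            = Any.here refl
∈-allSubsets (inside  ∷ p) = ∈-++⁺ˡ (∈-map⁺ (inside ∷_) (∈-allSubsets p))
∈-allSubsets (outside ∷ p) =
  ∈-++⁺ʳ (map (inside ∷_) (allSubsets _)) (∈-map⁺ (outside ∷_) (∈-allSubsets p))

∑-allSubsets-suc : ∀ {n} (f : Subset (suc n) → ℤ) →
  ∑ (allSubsets (suc n)) f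
  ≡ ∑[ p ∈ allSubsets n ] f (inside ∷ p) + ∑[ p ∈ allSubsets n ] f (outside ∷ p)
∑-allSubsets-suc {n} f =
  trans (∑-++ (map (inside ∷_) (allSubsets n)) _ f)
        (cong₂ _+_ (∑-map (inside ∷_) (allSubsets n) f) (∑-map (outside ∷_) (allSubsets n) f))

∑-allSubsets-⊥ : ∀ {n} {f : Subset n → ℤ} → (∀ p → Nonempty p → f p ≡ + 0) →
                 ∑[ p ∈ allSubsets n ] f p ≡ f ⊥
∑-allSubsets-⊥ {zero}  f≗0 = ℤ.+-identityʳ _
∑-allSubsets-⊥ {suc n} {f} f≗0 = begin
    ∑ (allSubsets (suc n)) f
  ≡⟨ ∑-allSubsets-suc f ⟩
    ∑[ p ∈ allSubsets n ] f (inside ∷ p) + ∑[ p ∈ allSubsets n ] f (outside ∷ p)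
  ≡⟨ cong₂ _+_ (∑-vanishes (allSubsets n) (λ p → f≗0 (inside ∷ p) (zero , here)))
               (∑-allSubsets-⊥ (λ p (x , x∈p) → f≗0 (outside ∷ p) (suc x , there x∈p))) ⟩
    + 0 + f ⊥
  ≡⟨ ℤ.+-identityˡ (f ⊥) ⟩
    f ⊥
  ∎
  where open ≡-Reasoning

paired : ∀ {n} → Fin n → (Subset n → ℤ) → Subset n → ℤ
paired i f p = if does (i ∈? p) then + 0 else f p + f (p ∪ ⁅ i ⁆)

∑-paired : ∀ {n} (i : Fin n) (f : Subset n → ℤ) → ∑ (allSubsets n) f ≡ ∑ (allSubsets n) (paired i f)
∑-paired {suc n} zero f = begin
    ∑ (allSubsets (suc n)) f
  ≡⟨ ∑-allSubsets-suc f ⟩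
    ∑[ p ∈ allSubsets n ] f (inside ∷ p) + ∑[ p ∈ allSubsets n ] f (outside ∷ p)
  ≡⟨ ℤ.+-comm (∑[ p ∈ allSubsets n ] f (inside ∷ p)) _ ⟩
    ∑[ p ∈ allSubsets n ] f (outside ∷ p) + ∑[ p ∈ allSubsets n ] f (inside ∷ p)
  ≡⟨ sym (∑-distrib-+ (allSubsets n) (λ p → f (outside ∷ p)) (λ p → f (inside ∷ p))) ⟩
    ∑[ p ∈ allSubsets n ] (f (outside ∷ p) + f (inside ∷ p))
  ≡⟨ ∑-cong (allSubsets n)
       (λ p → cong (λ q → f (outside ∷ p) + f (inside ∷ q)) (sym (∪-identityʳ p))) ⟩
    ∑[ p ∈ allSubsets n ] paired zero f (outside ∷ p)
  ≡⟨ sym (ℤ.+-identityˡ _) ⟩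
    + 0 + ∑[ p ∈ allSubsets n ] paired zero f (outside ∷ p)
  ≡⟨ cong₂ _+_ (sym (∑-vanishes (allSubsets n) (λ _ → refl))) refl ⟩
    ∑[ p ∈ allSubsets n ] paired zero f (inside ∷ p)
      + ∑[ p ∈ allSubsets n ] paired zero f (outside ∷ p)
  ≡⟨ sym (∑-allSubsets-suc (paired zero f)) ⟩
    ∑ (allSubsets (suc n)) (paired zero f)
  ∎
  where open ≡-Reasoning
∑-paired {suc n} (suc i) f =
  trans (∑-allSubsets-suc f)
        (trans (cong₂ _+_ (∑-paired i (f ∘ (inside ∷_))) (∑-paired i (f ∘ (outside ∷_))))
               (sym (∑-allSubsets-suc (paired (suc i) f))))

IntervalIn : ∀ {n} → Pred (Subset n) 0ℓ → Subset n → Subset n → Set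
IntervalIn F A B = ∀ C → C ∈[ A , B ] → F C

CubeIn : ∀ {n} → Pred (Subset n) 0ℓ → Subset n → Subset n → Set
CubeIn F A B = A ⊆ B × IntervalIn F A B

⌊⌋-reflects : ∀ {P : Set} (P? : Dec P) → Reflects P ⌊ P? ⌋
⌊⌋-reflects (true  because [p])  = [p]
⌊⌋-reflects (false because [¬p]) = [¬p]

allᵇ-reflects : ∀ {X : Set} {P : Pred X 0ℓ} {p : X → Bool} →
                (∀ x → Reflects (P x) (p x)) → ∀ xs → Reflects (All P xs) (allᵇ p xs)
allᵇ-reflects         r []       = ofʸ []
allᵇ-reflects {p = p} r (x ∷ xs) with p x ∧ allᵇ p xs | r x ×-reflects allᵇ-reflects r xs
... | true  | ofʸ (px , pxs) = ofʸ (px ∷ pxs)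
... | false | ofⁿ ¬px×pxs    = ofⁿ (λ { (px ∷ pxs) → ¬px×pxs (px , pxs) })

module _ {n} {F : Pred (Subset n) 0ℓ} (F? : Decidable F) where

  intervalIn? : ∀ A B → Dec (IntervalIn F A B)
  intervalIn? A B =
    map′ (λ all C → All.lookup all (∈-allSubsets C)) (λ ∀F → All.universal ∀F (allSubsets n))
         (intervalInᵇ F? A B because allᵇ-reflects C-reflects (allSubsets n))
    where
    C-reflects : ∀ C → Reflects (C ∈[ A , B ] → F C) _
    C-reflects C =
      (⌊⌋-reflects (A ⊆? C) ×-reflects ⌊⌋-reflects (C ⊆? B)) →-reflects ⌊⌋-reflects (F? C)

  cube? : ∀ A B → Dec (CubeIn F A B)
  cube? A B = ⌊ A ⊆? B ⌋ ∧ intervalInᵇ F? A B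
              because (⌊⌋-reflects (A ⊆? B) ×-reflects proof (intervalIn? A B))

  signedCube : Subset n → Subset n → ℤ
  signedCube A B = if does (cube? A B) then sign ∣ B ─ A ∣ else + 0

  χ-at : Subset n → ℤ
  χ-at B = ∑[ A ∈ allSubsets n ] signedCube A B

  signedCube-cube : ∀ {A B} → CubeIn F A B → signedCube A B ≡ sign ∣ B ─ A ∣
  signedCube-cube {A} {B} c =
    cong (λ b → if b then sign ∣ B ─ A ∣ else + 0) (dec-true (cube? A B) c)

  signedCube-¬cube : ∀ {A B} → ¬ CubeIn F A B → signedCube A B ≡ + 0
  signedCube-¬cube {A} {B} ¬c =
    cong (λ b → if b then sign ∣ B ─ A ∣ else + 0) (dec-false (cube? A B) ¬c)

  χ-at-⊥ : F ⊥ → χ-at ⊥ ≡ + 1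
  χ-at-⊥ F⊥ = begin
      χ-at ⊥
    ≡⟨ ∑-allSubsets-⊥ (λ A (x , x∈A) → signedCube-¬cube (λ (A⊆⊥ , _) → ∉⊥ (A⊆⊥ x∈A))) ⟩
      signedCube ⊥ ⊥
    ≡⟨ signedCube-cube (⊆-refl , λ C (_ , C⊆⊥) → subst F (⊆-antisym ⊥⊆ C⊆⊥) F⊥) ⟩
      sign ∣ ⊥ {n} ─ ⊥ ∣
    ≡⟨ cong (sign ∘ ∣_∣) (p─⊥≡p (⊥ {n})) ⟩
      sign ∣ ⊥ {n} ∣
    ≡⟨ cong sign (∣⊥∣≡0 n) ⟩
      + 1
    ∎
    where open ≡-Reasoning

  χ-at-∉ : ∀ {B} → ¬ F B → χ-at B ≡ + 0
  χ-at-∉ {B} B∉F = ∑-vanishes (allSubsets n)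
    (λ A → signedCube-¬cube (λ (A⊆B , [A,B]⊆F) → B∉F ([A,B]⊆F B (A⊆B , ⊆-refl))))

if-then-neg : ∀ b (x : ℤ) → (if b then - x else + 0) ≡ - (if b then x else + 0)
if-then-neg true  x = refl
if-then-neg false x = refl

module _ {n} {F : Pred (Subset n) 0ℓ} (F? : Decidable F) {B : Subset n} {i : Fin n}
         (i∈B : i ∈ B) (root : IntervalIn F ⁅ i ⁆ B) where

  intervalIn-extend : ∀ {A} → IntervalIn F A (B - i) → IntervalIn F A B
  intervalIn-extend [A,B-i]⊆F C (A⊆C , C⊆B) with i ∈? C
  ... | yes i∈C = root C (x∈p⇒⁅x⁆⊆p i∈C , C⊆B)
  ... | no  i∉C = [A,B-i]⊆F C (A⊆C , x∉p∧p⊆q⇒p⊆q-x i∉C C⊆B)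

  cube-delete⇔ : ∀ {A} → i ∉ A → CubeIn F A B ⇔ CubeIn F A (B - i)
  cube-delete⇔ i∉A = mk⇔
    (λ (A⊆B , [A,B]⊆F) → x∉p∧p⊆q⇒p⊆q-x i∉A A⊆B ,
                          λ C (A⊆C , C⊆B-i) → [A,B]⊆F C (A⊆C , ⊆-trans C⊆B-i (p─q⊆p B ⁅ i ⁆)))
    (λ (A⊆B-i , [A,B-i]⊆F) → ⊆-trans A⊆B-i (p─q⊆p B ⁅ i ⁆) , intervalIn-extend [A,B-i]⊆F)

  cube-insert⇔ : ∀ {A} → i ∉ A → CubeIn F (A ∪ ⁅ i ⁆) B ⇔ CubeIn U A (B - i)
  cube-insert⇔ {A} i∉A = mk⇔
    (λ (A∪i⊆B , _) → x∉p∧p⊆q⇒p⊆q-x i∉A (⊆-trans (p⊆p∪q ⁅ i ⁆) A∪i⊆B) , _)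
    (λ (A⊆B-i , _) → p⊆r∧q⊆r⇒p∪q⊆r (⊆-trans A⊆B-i (p─q⊆p B ⁅ i ⁆)) (x∈p⇒⁅x⁆⊆p i∈B) ,
                      λ C (A∪i⊆C , C⊆B) → root C (⊆-trans (q⊆p∪q A ⁅ i ⁆) A∪i⊆C , C⊆B))

  signedCube-delete : ∀ {A} → i ∉ A → signedCube F? A B ≡ - signedCube F? A (B - i)
  signedCube-delete {A} i∉A = trans
    (cong₂ (λ b k → if b then sign k else + 0)
           (does-⇔ (cube-delete⇔ i∉A) (cube? F? A B) (cube? F? A (B - i)))
           (x∈p∧x∉q⇒∣p─q∣≡1+∣p-x─q∣ i∈B i∉A))
    (if-then-neg (does (cube? F? A (B - i))) _)

  signedCube-insert : ∀ {A} → i ∉ A → signedCube F? (A ∪ ⁅ i ⁆) B ≡ signedCube U? A (B - i)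
  signedCube-insert {A} i∉A =
    cong₂ (λ b k → if b then sign k else + 0)
          (does-⇔ (cube-insert⇔ i∉A) (cube? F? (A ∪ ⁅ i ⁆) B) (cube? U? A (B - i)))
          (cong ∣_∣ (p─q∪⁅x⁆≡p-x─q B A i))

  pairedCubes : ∀ {G : Pred (Subset n) 0ℓ} → Decidable G → Subset n → Subset n → ℤ
  pairedCubes G? B′ = paired i (λ A → signedCube G? A B′)

  pairedCubes-delete-root : ∀ A → pairedCubes F? B A
                                ≡ - pairedCubes F? (B - i) A + pairedCubes U? (B - i) A
  pairedCubes-delete-root A with i ∈? A
  ... | yes _   = refl
  ... | no i∉A = begin
      signedCube F? A B + signedCube F? (A ∪ ⁅ i ⁆) B
    ≡⟨ cong₂ _+_ (signedCube-delete i∉A) (signedCube-insert i∉A) ⟩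
      - signedCube F? A (B - i) + signedCube U? A (B - i)
    ≡⟨ sym (cong₂ (λ x y → - x + y) (drop-insert F?) (drop-insert U?)) ⟩
      - (signedCube F? A (B - i) + signedCube F? (A ∪ ⁅ i ⁆) (B - i))
        + (signedCube U? A (B - i) + signedCube U? (A ∪ ⁅ i ⁆) (B - i))
    ∎
    where
    open ≡-Reasoning
    drop-insert : ∀ {G : Pred (Subset n) 0ℓ} (G? : Decidable G) →
                  signedCube G? A (B - i) + signedCube G? (A ∪ ⁅ i ⁆) (B - i)
                  ≡ signedCube G? A (B - i)
    drop-insert G? = trans
      (cong (_+_ (signedCube G? A (B - i)))
            (signedCube-¬cube G? (λ (A∪i⊆B-i , _) → x∉p-x B (A∪i⊆B-i (q⊆p∪q A ⁅ i ⁆ (x∈⁅x⁆ i))))))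
      (ℤ.+-identityʳ _)

  χ-at-delete-root : χ-at F? B ≡ - χ-at F? (B - i) + χ-at U? (B - i)
  χ-at-delete-root = begin
      χ-at F? B
    ≡⟨ ∑-paired i _ ⟩
      ∑ (allSubsets n) (pairedCubes F? B)
    ≡⟨ ∑-cong (allSubsets n) pairedCubes-delete-root ⟩
      ∑[ A ∈ allSubsets n ] (- pairedCubes F? (B - i) A + pairedCubes U? (B - i) A)
    ≡⟨ ∑-distrib-+ (allSubsets n) _ _ ⟩
      ∑[ A ∈ allSubsets n ] (- pairedCubes F? (B - i) A) + ∑ (allSubsets n) (pairedCubes U? (B - i))
    ≡⟨ cong₂ _+_ (∑-neg (allSubsets n) _) refl ⟩
      - ∑ (allSubsets n) (pairedCubes F? (B - i)) + ∑ (allSubsets n) (pairedCubes U? (B - i))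
    ≡⟨ sym (cong₂ (λ x y → - x + y) (∑-paired i _) (∑-paired i _)) ⟩
      - χ-at F? (B - i) + χ-at U? (B - i)
    ∎
    where open ≡-Reasoning

SimplyRooted-U : ∀ {n} → SimplyRooted {n} U
SimplyRooted-U _ _ (x , x∈A) = x , x∈A , _

χ-at-nonempty : ∀ {n} {F : Pred (Subset n) 0ℓ} (F? : Decidable F) → SimplyRooted F → F ⊥ →
                ∀ B → Nonempty B → χ-at F? B ≡ + 0
χ-at-nonempty F? rooted F⊥ B = go F? rooted F⊥ B (<-wellFounded ∣ B ∣)
  where
  go : ∀ {n} {F : Pred (Subset n) 0ℓ} (F? : Decidable F) → SimplyRooted F → F ⊥ →
       ∀ B → Acc _<_ ∣ B ∣ → Nonempty B → χ-at F? B ≡ + 0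
  go {n} F? rooted F⊥ B (acc smaller) B≠∅ with F? B
  ... | no  B∉F = χ-at-∉ F? B∉F
  ... | yes B∈F with rooted B B∈F B≠∅
  ...   | i , i∈B , root = begin
      χ-at F? B
    ≡⟨ χ-at-delete-root F? i∈B root ⟩
      - χ-at F? (B - i) + χ-at U? (B - i)
    ≡⟨ cong (λ x → - x + χ-at U? (B - i)) F≡U ⟩
      - χ-at U? (B - i) + χ-at U? (B - i)
    ≡⟨ ℤ.+-inverseˡ (χ-at U? (B - i)) ⟩
      + 0
    ∎
    where
    open ≡-Reasoning

    F≡U : χ-at F? (B - i) ≡ χ-at U? (B - i)
    F≡U with nonempty? (B - i)
    ... | yes B-i≠∅ = trans (go F? rooted F⊥ (B - i) (smaller (x∈p⇒∣p-x∣<∣p∣ i∈B)) B-i≠∅)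
                      (sym (go U? SimplyRooted-U _ (B - i) (smaller (x∈p⇒∣p-x∣<∣p∣ i∈B)) B-i≠∅))
    ... | no  B-i=∅ rewrite Empty-unique B-i=∅ = trans (χ-at-⊥ F? F⊥) (sym (χ-at-⊥ {n} U? _))

corollary1p3 : (n : ℕ) → n ≥ 1 → (F : Pred (Subset n) 0ℓ) → (F? : Decidable F) →
    SimplyRooted F → F ⊥ →
    sumTo n (λ k → sign k * + countC F? k) ≡ + 1
corollary1p3 n _ F F? rooted F⊥ = begin
    sumTo n (λ k → sign k * + countC F? k)
  ≡⟨ sumTo-weighted-counts sign (λ (A , B) → does (cube? F? A B)) (λ (A , B) → ∣ B ─ A ∣) _
       (λ k (A , B) → sym (∧-assoc ⌊ A ⊆? B ⌋ _ _)) (λ (A , B) → ∣p∣≤n (B ─ A)) pairs ⟩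
    ∑ pairs (λ (A , B) → signedCube F? A B)
  ≡⟨ ∑-pairs (allSubsets n) (allSubsets n) _ ⟩
    ∑[ A ∈ allSubsets n ] ∑[ B ∈ allSubsets n ] signedCube F? A B
  ≡⟨ ∑-comm (allSubsets n) (allSubsets n) (signedCube F?) ⟩
    ∑[ B ∈ allSubsets n ] χ-at F? B
  ≡⟨ ∑-allSubsets-⊥ (χ-at-nonempty F? rooted F⊥) ⟩
    χ-at F? ⊥
  ≡⟨ χ-at-⊥ F? F⊥ ⟩
    + 1
  ∎
  where
  open ≡-Reasoning
  pairs : List (Subset n × Subset n)
  pairs = concatMap (λ A → map (A ,_) (allSubsets n)) (allSubsets n)
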